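{- Let $\mathcal{I}$ be an instance of the basic version with $|U(\mathcal{I})|=q$ and let $\mathcal{F}$ be a set of feasible assignments for $\mathcal{I}$. If $D^{\mathcal{I},\mathcal{F}}$ is Eulerian, then there exists a balanced feasible assignment for $\mathcal{I}$ that is periodic with period $q$.
   Context: Basic instance: $n$ intervals $[s_i,e_i)\subseteq(-1,1)$, $i\in[n]$, with $e_i\in(0,1]$, $e_i-s_i\le1$, and $q\in\mathbb{Z}_{>0}$ (workers $[q]$); the $r$th occurrence ($r\in\mathbb{Z}_{>0}$) of task $i$ is $[s_i+r,e_i+r)$. An assignment $f:[n]\times\mathbb{Z}_{>0}\to[q]$ is feasible if for $i\ne i'$, $[s_i+r,e_i+r)\cap[s_{i'}+r',e_{i'}+r')\ne\varnothing$ implies $f(i,r)\ne f(i',r')$; balanced if for all $i\in[n]$, $j\in[q]$, $\lim_{t\to\infty}\frac1t|\{r\in[t]:f(i,r)=j\}|$ exists and equals $1/q$; periodic with period $h$ if $f(i,r)=f(i,r+h)$ for all $i,r$. $U(\mathcal{I})=\{i:s_i\le0\}$. For a set $\mathcal{F}$ of feasible assignments, $D^{\mathcal{I},\mathcal{F}}$ is the directed multigraph with vertex set $U(\mathcal{I})$ having, for each $f\in\mathcal{F}$ and $i\in U(\mathcal{I})$, one arc labeled $f$ from $i$ to the unique $i'\in U(\mathcal{I})$ with $f(i,1)=f(i',2)$. Eulerian: a closed walk traversing every arc exactly once and passing through every vertex.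
   Formalization: The interval endpoints $s_i$ and $e_i$ of the basic instance are rational numbers. -}

module Defs where

open import Data.Nat as ℕ using (ℕ; zero; suc; NonZero)
open import Data.Integer using (+_)
open import Data.Rational using (ℚ; 0ℚ; 1ℚ; _+_; _-_; _*_; -_; _≤_; _<_; ∣_∣; _/_)
open import Data.Rational.Properties using (_≤?_)
open import Data.Fin using (Fin)
open import Data.Fin.Properties using () renaming (_≟_ to _≟ᶠ_)
open import Data.List using (List; []; _∷_; _++_; [_]; length; filter; allFin)
open import Data.List.Membership.Propositional using (_∈_)
open import Data.List.Relation.Unary.All using (All)
open import Data.List.Relation.Unary.Unique.Propositional using (Unique)
open import Data.List.Relation.Unary.Linked using (Linked)
open import Data.Product using (Σ; ∃; ∃-syntax; _×_; _,_)
open import Relation.Binary.PropositionalEquality using (_≡_; _≢_)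
open import Relation.Nullary.Decidable using (does)
open import Data.Bool using (true; false)

ℕtoℚ : ℕ → ℚ
ℕtoℚ r = (+ r) / 1

-- A basic instance: n tasks with intervals [s i , e i) and q workers.
record Instance : Set where
  field
    n    : ℕ
    q    : ℕ
    {{q≢0}} : NonZero q
    s    : Fin n → ℚ
    e    : Fin n → ℚ
    s>-1 : ∀ i → - 1ℚ < s i
    e>0  : ∀ i → 0ℚ < e i
    e≤1  : ∀ i → e i ≤ 1ℚ
    len≤1 : ∀ i → e i - s i ≤ 1ℚ

open Instance public

-- Assignments: f i r is the worker of the r-th occurrence of task i
-- (only r ≥ 1 is meaningful; the value at r = 0 is irrelevant).
Assignment : Instance → Set
Assignment I = Fin (n I) → ℕ → Fin (q I)

Intersect : ℚ → ℚ → ℚ → ℚ → Set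
Intersect a b c d = ∃[ x ] ((a ≤ x × x < b) × (c ≤ x × x < d))

Overlap : (I : Instance) → Fin (n I) → ℕ → Fin (n I) → ℕ → Set
Overlap I i r i' r' =
  Intersect (s I i + ℕtoℚ r) (e I i + ℕtoℚ r) (s I i' + ℕtoℚ r') (e I i' + ℕtoℚ r')

Feasible : (I : Instance) → Assignment I → Set
Feasible I f = ∀ (i i' : Fin (n I)) (r r' : ℕ) → 1 ℕ.≤ r → 1 ℕ.≤ r' → i ≢ i' →
  Overlap I i r i' r' → f i r ≢ f i' r'

countUpTo : {k : ℕ} → (ℕ → Fin k) → Fin k → ℕ → ℕ
countUpTo g j zero = zero
countUpTo g j (suc t) with does (g (suc t) ≟ᶠ j)
... | true  = suc (countUpTo g j t)
... | false = countUpTo g j t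

Balanced : (I : Instance) → Assignment I → Set
Balanced I f = ∀ (i : Fin (n I)) (j : Fin (q I)) (ε : ℚ) → 0ℚ < ε →
  ∃[ T ] ∀ (t : ℕ) → T ℕ.≤ t →
    ∣ ((+ countUpTo (f i) j (suc t)) / suc t) - ((+ 1) / q I) ∣ < ε
  where instance _ = q≢0 I

Periodic : (I : Instance) → Assignment I → ℕ → Set
Periodic I f h = ∀ (i : Fin (n I)) (r : ℕ) → 1 ℕ.≤ r → f i r ≡ f i (r ℕ.+ h)

InU : (I : Instance) → Fin (n I) → Set
InU I i = s I i ≤ 0ℚ

sizeU : Instance → ℕ
sizeU I = length (filter (λ i → s I i ≤? 0ℚ) (allFin (n I)))

-- A finite set of feasible assignments, given as an injective family
-- (distinct indices give extensionally distinct assignments).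
record AssignmentSet (I : Instance) : Set where
  field
    m         : ℕ
    F         : Fin m → Assignment I
    feasible  : ∀ k → Feasible I (F k)
    distinct  : ∀ k k' → k ≢ k' → ∃[ i ] ∃[ r ] (1 ℕ.≤ r × F k i r ≢ F k' i r)

open AssignmentSet public

-- Arcs of D^{I,F}: the arc labelled F k leaving vertex i ∈ U(I) is named (k , i).
Arc : (I : Instance) → AssignmentSet I → Set
Arc I 𝓕 = Fin (m 𝓕) × Fin (n I)

IsArc : (I : Instance) (𝓕 : AssignmentSet I) → Arc I 𝓕 → Set
IsArc I 𝓕 (k , i) = InU I i

ArcTo : (I : Instance) (𝓕 : AssignmentSet I) → Arc I 𝓕 → Fin (n I) → Set
ArcTo I 𝓕 (k , i) i' = InU I i' × F 𝓕 k i 1 ≡ F 𝓕 k i' 2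

Follows : (I : Instance) (𝓕 : AssignmentSet I) → Arc I 𝓕 → Arc I 𝓕 → Set
Follows I 𝓕 a (k' , i') = ArcTo I 𝓕 a i'

ClosedWalk : (I : Instance) (𝓕 : AssignmentSet I) → List (Arc I 𝓕) → Set
ClosedWalk I 𝓕 w = ∃[ a ] ∃[ as ] (w ≡ a ∷ as × Linked (Follows I 𝓕) (a ∷ as ++ [ a ]))

Eulerian : (I : Instance) → AssignmentSet I → Set
Eulerian I 𝓕 = ∃[ w ]
  ( ClosedWalk I 𝓕 w
  × All (IsArc I 𝓕) w
  × Unique w
  × (∀ (a : Arc I 𝓕) → IsArc I 𝓕 a → a ∈ w)
  × (∀ (i : Fin (n I)) → InU I i → ∃[ k ] ((k , i) ∈ w)) )

-- Every occurrence lies within one day of its nominal day, so feasibility only relates occurrences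
-- on equal or consecutive days, and at every integer time the q tasks of U(I) keep all q workers busy.
-- Hence a feasible g determines a permutation σ of the workers with σ (g u 1) = g u 2 for u ∈ U(I),
-- and when σ is a single q-cycle, (i , r) ↦ σ^(r-1) (g i 1) is feasible, q-periodic, and gives
-- every task each worker exactly once in any q consecutive days, hence is balanced.
--
-- Starting from any g ∈ F, the cycle of σ through some worker is grown until it has length q.
-- Once it closes early, colour the workers by membership in it. A closed walk of D through every
-- vertex (all that is used of Eulerianity) contains an arc u → u′ of some h ∈ F whose day-1 workers
-- under g have different colours. Between the end of (u,1) and the start of (u′,2), where the worker
-- h u 1 = h u′ 2 is free, a search over the finitely many interval endpoints, using that g and h
-- leave equally many workers free at every time, finds a time τ ∈ (1,2] at which g leaves a worker of
-- each colour free. Exchanging these two workers from τ on keeps g feasible and composes σ with their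
-- transposition, which splices the other cycle into the growing one.

{-# OPTIONS --safe #-}
module Submission where

open import Data.Bool using (Bool; true; false)
import Data.Bool.Properties as Bool
open import Data.Empty using (⊥; ⊥-elim)
open import Data.Fin as Fin using (Fin; zero; suc; toℕ)
open import Data.Fin.Permutation.Components using (transpose; transpose-inverse)
open import Data.Fin.Properties using (_≟_; any?; ¬∀⟶∃¬; injective⇒≤; toℕ-injective; toℕ<n; toℕ-fromℕ<)
open import Data.Integer as ℤ using (ℤ; +_; -[1+_]; _⊖_)
import Data.Integer.Properties as ℤ
open import Data.List using (List; []; _∷_; lookup; filter; allFin; concatMap)
open import Data.List.Membership.Propositional using (_∈_; lose)
open import Data.List.Membership.Propositional.Properties using (∈-lookup; ∈-filter⁻; ∈-allFin; ∈-concatMap⁺; ∈-++⁺ˡ)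
import Data.List.Relation.Unary.All as All
import Data.List.Relation.Unary.All.Properties as All
open import Data.List.Relation.Unary.AllPairs using (_∷_)
open import Data.List.Relation.Unary.Any using (here; there)
open import Data.List.Relation.Unary.Any.Properties using (¬Any[])
open import Data.List.Relation.Unary.Linked using (Linked; [-]; _∷_)
open import Data.List.Relation.Unary.Unique.Propositional using (Unique)
import Data.List.Relation.Unary.Unique.Propositional.Properties as Unique
open import Data.Nat as ℕ using (ℕ; zero; suc; s≤s; z≤n; NonZero; _∸_)
open import Data.Nat.Coprimality using (Coprime)
open import Data.Nat.DivMod using (_%_; _/_; m≡m%n+[m/n]*n; m%n<n)
import Data.Nat.Properties as ℕ
open import Data.Product using (∃; ∃-syntax; _×_; _,_; proj₁; proj₂)
open import Data.Product.Properties using (≡-dec)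
open import Data.Rational using (ℚ; mkℚ; toℚᵘ; 0ℚ; 1ℚ; _+_; _-_; -_; ∣_∣; _<_; _≤_; *<*)
import Data.Rational as ℚ
import Data.Rational.Properties as ℚ
open import Data.Rational.Properties
  using (≤-refl; ≤-trans; <⇒≤; <-irrefl; <-trans; ≤-<-trans; <-≤-trans; ≮⇒≥; ≰⇒>; ≤-antisym; <-dense;
         _≤?_; _<?_; +-monoˡ-≤; +-monoʳ-≤; +-monoˡ-<; +-monoʳ-<; +-identityˡ)
open import Data.Rational.Solver using (module +-*-Solver)
import Data.Rational.Unnormalised as ℚᵘ
import Data.Rational.Unnormalised.Properties as ℚᵘ
open import Data.Sum using (_⊎_; inj₁; inj₂; [_,_]′)
open import Function using (_∘_; Injective)
open import Relation.Binary.Definitions using (tri<; tri≈; tri>)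
open import Relation.Binary.PropositionalEquality
open import Relation.Nullary using (¬_; Dec; yes; no; does; contradiction; _×-dec_)
open import Relation.Nullary.Decidable using (dec-true; dec-false)

open import Defs hiding (feasible; distinct)

<⇒≱ : ∀ {x y : ℚ} → x < y → ¬ y ≤ x
<⇒≱ x<y y≤x = <-irrefl refl (<-≤-trans x<y y≤x)

ℕtoℚ≃mkℚᵘ : ∀ r → toℚᵘ (ℕtoℚ r) ℚᵘ.≃ ℚᵘ.mkℚᵘ (+ r) 0
ℕtoℚ≃mkℚᵘ r = ℚ.toℚᵘ-fromℚᵘ (ℚᵘ.mkℚᵘ (+ r) 0)

ℕtoℚ-+ : ∀ a b → ℕtoℚ (a ℕ.+ b) ≡ ℕtoℚ a + ℕtoℚ b
ℕtoℚ-+ a b = ℚ.toℚᵘ-injective (begin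
  toℚᵘ (ℕtoℚ (a ℕ.+ b))                      ≈⟨ ℕtoℚ≃mkℚᵘ (a ℕ.+ b) ⟩
  ℚᵘ.mkℚᵘ (+ (a ℕ.+ b)) 0                     ≈⟨ ℚᵘ.*≡* numerators ⟩
  ℚᵘ.mkℚᵘ (+ a) 0 ℚᵘ.+ ℚᵘ.mkℚᵘ (+ b) 0       ≈⟨ ℚᵘ.+-cong (ℕtoℚ≃mkℚᵘ a) (ℕtoℚ≃mkℚᵘ b) ⟨
  toℚᵘ (ℕtoℚ a) ℚᵘ.+ toℚᵘ (ℕtoℚ b)           ≈⟨ ℚ.toℚᵘ-homo-+ (ℕtoℚ a) (ℕtoℚ b) ⟨
  toℚᵘ (ℕtoℚ a + ℕtoℚ b)                   ∎)
  where
  open ℚᵘ.≃-Reasoning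
  numerators : + (a ℕ.+ b) ℤ.* + 1 ≡ (+ a ℤ.* + 1 ℤ.+ + b ℤ.* + 1) ℤ.* + 1
  numerators rewrite ℤ.*-identityʳ (+ (a ℕ.+ b)) | ℤ.*-identityʳ (+ a) | ℤ.*-identityʳ (+ b)
                   | ℤ.*-identityʳ (+ a ℤ.+ + b) = refl

ℕtoℚ-mono-≤ : ∀ {a b} → a ℕ.≤ b → ℕtoℚ a ≤ ℕtoℚ b
ℕtoℚ-mono-≤ {a} {b} a≤b = ℚ.toℚᵘ-cancel-≤
  (ℚᵘ.≤-respʳ-≃ (ℚᵘ.≃-sym (ℕtoℚ≃mkℚᵘ b)) (ℚᵘ.≤-respˡ-≃ (ℚᵘ.≃-sym (ℕtoℚ≃mkℚᵘ a))
    (ℚᵘ.*≤* (ℤ.*-monoʳ-≤-nonNeg (+ 1) (ℤ.+≤+ a≤b)))))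

ℕtoℚ-cancel-< : ∀ {a b} → ℕtoℚ a < ℕtoℚ b → a ℕ.< b
ℕtoℚ-cancel-< {a} {b} lt with a ℕ.<? b
... | yes a<b = a<b
... | no a≮b = contradiction (ℕtoℚ-mono-≤ (ℕ.≮⇒≥ a≮b)) (<⇒≱ lt)

injective⇒surjective : ∀ {m n} {f : Fin m → Fin n} → n ℕ.≤ m → Injective _≡_ _≡_ f →
                       ∀ y → ∃ λ x → f x ≡ y
injective⇒surjective {m} {n} {f} n≤m f-inj y with any? (λ x → f x ≟ y)
... | yes hit = hit
... | no miss = contradiction (injective⇒≤ y∷f-injective) (ℕ.<⇒≱ (s≤s n≤m))
  where
  y∷f : Fin (suc m) → Fin n
  y∷f zero    = y
  y∷f (suc x) = f x
  y∷f-injective : Injective _≡_ _≡_ y∷f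
  y∷f-injective {zero}  {zero}  _  = refl
  y∷f-injective {zero}  {suc x} eq = contradiction (x , sym eq) miss
  y∷f-injective {suc x} {zero}  eq = contradiction (x , eq) miss
  y∷f-injective {suc x} {suc x′} eq = cong suc (f-inj eq)

lookup-injective : ∀ {A : Set} {xs : List A} → Unique xs → Injective _≡_ _≡_ (lookup xs)
lookup-injective {xs = _ ∷ _} (_  ∷ _) {zero}  {zero}  _  = refl
lookup-injective {xs = _ ∷ _} (x∉ ∷ _) {zero}  {suc j} eq = contradiction eq (All.lookup x∉ (∈-lookup j))
lookup-injective {xs = _ ∷ _} (x∉ ∷ _) {suc i} {zero}  eq = contradiction (sym eq) (All.lookup x∉ (∈-lookup i))
lookup-injective {xs = _ ∷ _} (_  ∷ u) {suc i} {suc j} eq = cong suc (lookup-injective u eq)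

transpose-matchˡ : ∀ {n} (i j : Fin n) → transpose i j i ≡ j
transpose-matchˡ i j with i ≟ i
... | yes _ = refl
... | no i≢i = contradiction refl i≢i

transpose-fixes : ∀ {n} {i j k : Fin n} → k ≢ i → k ≢ j → transpose i j k ≡ k
transpose-fixes {i = i} {j} {k} k≢i k≢j with k ≟ i
... | yes k≡i = contradiction k≡i k≢i
... | no _ with k ≟ j
...   | yes k≡j = contradiction k≡j k≢j
...   | no _ = refl

transpose-injective : ∀ {n} (i j : Fin n) → Injective _≡_ _≡_ (transpose i j)
transpose-injective i j {k} {k′} eq =
  trans (sym (transpose-inverse j i)) (trans (cong (transpose j i) eq) (transpose-inverse j i))

-- Orbits of an endofunction of Fin Q

module Orbit {Q : ℕ} (σ : Fin Q → Fin Q) where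

  open import Function.Endo.Propositional (Fin Q) using (_^_; ^-homo)

  ^-+ : ∀ a b x → (σ ^ (a ℕ.+ b)) x ≡ (σ ^ a) ((σ ^ b) x)
  ^-+ a b = cong-app (^-homo σ a b)

  ^-comm : ∀ a b x → (σ ^ a) ((σ ^ b) x) ≡ (σ ^ b) ((σ ^ a) x)
  ^-comm a b x = trans (sym (^-+ a b x)) (trans (cong (λ c → (σ ^ c) x) (ℕ.+-comm a b)) (^-+ b a x))

  Distinct : Fin Q → ℕ → Set
  Distinct x k = ∀ {j j′} → j ℕ.< k → j′ ℕ.< k → (σ ^ j) x ≡ (σ ^ j′) x → j ≡ j′

  Visits : Fin Q → ℕ → Fin Q → Set
  Visits x k w = ∃ λ j → j ℕ.< k × (σ ^ j) x ≡ w

  visits? : ∀ x k w → Dec (Visits x k w)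
  visits? x k w = ℕ.anyUpTo? (λ j → (σ ^ j) x ≟ w) k

  distinct-extend : ∀ {x k} → Distinct x k → ¬ Visits x k ((σ ^ k) x) → Distinct x (suc k)
  distinct-extend d new {j} {j′} j<1+k j′<1+k eq
    with ℕ.m<1+n⇒m<n∨m≡n j<1+k | ℕ.m<1+n⇒m<n∨m≡n j′<1+k
  ... | inj₁ j<k  | inj₁ j′<k = d j<k j′<k eq
  ... | inj₁ j<k  | inj₂ refl = contradiction (j , j<k , eq) new
  ... | inj₂ refl | inj₁ j′<k = contradiction (j′ , j′<k , sym eq) new
  ... | inj₂ refl | inj₂ refl = refl

  visits-all : ∀ {x} → Distinct x Q → ∀ w → Visits x Q w
  visits-all {x} d w =
    let j , eq = injective⇒surjective ℕ.≤-refl iterate-injective w in toℕ j , toℕ<n j , eq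
    where
    iterate-injective : Injective _≡_ _≡_ (λ (j : Fin Q) → (σ ^ toℕ j) x)
    iterate-injective {j} {j′} eq = toℕ-injective (d (toℕ<n j) (toℕ<n j′) eq)

  return-^ : ∀ {x k} a → (σ ^ k) x ≡ x → (σ ^ k) ((σ ^ a) x) ≡ (σ ^ a) x
  return-^ {x} {k} a ret = trans (^-comm k a x) (cong (σ ^ a) ret)

  visits-σ : ∀ {x k w} → (σ ^ k) x ≡ x → Visits x k w → Visits x k (σ w)
  visits-σ ret (j , j<k , refl) with ℕ.m≤n⇒m<n∨m≡n j<k
  ... | inj₁ 1+j<k = suc j , 1+j<k , refl
  ... | inj₂ refl  = zero , ℕ.z<s , sym ret

  visits-^ : ∀ {x k w} → (σ ^ k) x ≡ x → Visits x k w → ∀ n → Visits x k ((σ ^ n) w)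
  visits-^ ret v zero    = v
  visits-^ ret v (suc n) = visits-σ ret (visits-^ ret v n)

  visits-rotate : ∀ {x k w} a → (σ ^ k) x ≡ x → Visits ((σ ^ a) x) k w → Visits x k w
  visits-rotate {x} {k} a ret (j , j<k , refl) =
    subst (Visits x k) (^-+ j a x) (visits-^ ret (zero , ℕ.≤-trans (s≤s z≤n) j<k , refl) (j ℕ.+ a))

  unvisited : ∀ {x k} → k ℕ.< Q → ∃ λ w → ¬ Visits x k w
  unvisited {x} {k} k<Q = ¬∀⟶∃¬ Q (Visits x k) (visits? x k)
    (λ all → ℕ.<⇒≱ k<Q (injective⇒≤ (index-injective all)))
    where
    index : (∀ w → Visits x k w) → Fin Q → Fin k
    index all w = Fin.fromℕ< (proj₁ (proj₂ (all w)))
    index-injective : ∀ all → Injective _≡_ _≡_ (index all)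
    index-injective all {w} {w′} eq with all w | all w′
    ... | j , _ , refl | j′ , _ , refl =
      cong (λ c → (σ ^ c) x) (trans (sym (toℕ-fromℕ< _)) (trans (cong toℕ eq) (toℕ-fromℕ< _)))

  module _ (σ-injective : Injective _≡_ _≡_ σ) where

    ^-injective : ∀ n → Injective _≡_ _≡_ (σ ^ n)
    ^-injective zero    eq = eq
    ^-injective (suc n) eq = ^-injective n (σ-injective eq)

    distinct-^ : ∀ {x k} a → Distinct x k → Distinct ((σ ^ a) x) k
    distinct-^ {x} a d {j} {j′} j<k j′<k eq =
      d j<k j′<k (^-injective a (trans (^-comm a j x) (trans eq (^-comm j′ a x))))

    visits-σ⁻ : ∀ {x k w} → (σ ^ k) x ≡ x → Visits x k (σ w) → Visits x k w
    visits-σ⁻ {k = zero}  _   (_ , () , _)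
    visits-σ⁻ {k = suc k} ret (zero , _ , eq)         = k , ℕ.n<1+n k , σ-injective (trans ret eq)
    visits-σ⁻ {k = suc k} ret (suc j , 1+j<1+k , eq) = j , ℕ.<-trans (ℕ.n<1+n j) 1+j<1+k , σ-injective eq

    distinct-return : ∀ {x k} → Distinct x k → Visits x k ((σ ^ k) x) → (σ ^ k) x ≡ x
    distinct-return {k = suc k} d (zero , _ , eq) = sym eq
    distinct-return {k = suc k} d (suc j , 1+j<1+k , eq) =
      contradiction (d (ℕ.m<n⇒m<1+n j<k) (ℕ.n<1+n k) (σ-injective eq)) (ℕ.<⇒≢ j<k)
      where j<k = ℕ.s<s⁻¹ 1+j<1+k

    full-cycle : ∀ {x} → Distinct x Q → ∀ w → Distinct w Q × (σ ^ Q) w ≡ w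
    full-cycle {x} d w with visits-all d w
    ... | a , _ , refl = distinct-^ a d , return-^ {k = Q} a (distinct-return d (visits-all d ((σ ^ Q) x)))

module _ {Q : ℕ} {σ : Fin Q → Fin Q} {y z : Fin Q} where

  open import Function.Endo.Propositional (Fin Q) using (_^_)
  open Orbit σ using (Distinct; Visits)
  private
    σ′ = transpose y z ∘ σ
    module O′ = Orbit σ′

  transpose-merges : ∀ {k} → Distinct y k → (σ ^ k) y ≡ y → ¬ Visits y k z → O′.Distinct y (suc k)
  transpose-merges {zero}  _ _   _  = O′.distinct-extend (λ ()) (λ { (_ , () , _) })
  transpose-merges {suc k} d ret z∉ = O′.distinct-extend d′ new
    where
    agree : ∀ {j} → j ℕ.< suc k → (σ′ ^ j) y ≡ (σ ^ j) y
    agree {zero}  _ = refl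
    agree {suc j} 1+j<1+k = trans (cong σ′ (agree (ℕ.<-trans (ℕ.n<1+n j) 1+j<1+k)))
      (transpose-fixes (λ eq → ℕ.1+n≢0 (d 1+j<1+k ℕ.z<s eq)) (λ eq → z∉ (suc j , 1+j<1+k , eq)))
    d′ : O′.Distinct y (suc k)
    d′ j< j′< eq = d j< j′< (trans (sym (agree j<)) (trans eq (agree j′<)))
    last : (σ′ ^ suc k) y ≡ z
    last = trans (cong σ′ (agree (ℕ.n<1+n k))) (trans (cong (transpose y z) ret) (transpose-matchˡ y z))
    new : ¬ O′.Visits y (suc k) ((σ′ ^ suc k) y)
    new (j , j< , eq) = z∉ (j , j< , trans (sym (agree j<)) (trans eq last))

ColourChange : ∀ {A : Set} → (A → A → Set) → (A → Bool) → List A → Set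
ColourChange R c xs = ∃ λ a → ∃ λ b → a ∈ xs × R a b × c a ≢ c b

linked-colour-change-from-head : ∀ {A : Set} {R : A → A → Set} (c : A → Bool) {x xs y} →
  Linked R (x ∷ xs) → y ∈ x ∷ xs → c y ≢ c x → ColourChange R c (x ∷ xs)
linked-colour-change-from-head c [-] (here refl) cy≢cx = contradiction refl cy≢cx
linked-colour-change-from-head c {x} {z ∷ _} (Rxz ∷ links) y∈ cy≢cx with c x Bool.≟ c z | y∈
... | no cx≢cz  | _          = x , z , here refl , Rxz , cx≢cz
... | yes _     | here refl  = contradiction refl cy≢cx
... | yes cx≡cz | there y∈zs
  with a , b , a∈ , Rab , ca≢cb ← linked-colour-change-from-head c links y∈zs (λ eq → cy≢cx (trans eq (sym cx≡cz)))
  = a , b , there a∈ , Rab , ca≢cb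

linked-colour-change : ∀ {A : Set} {R : A → A → Set} (c : A → Bool) {x xs y y′} →
  Linked R (x ∷ xs) → y ∈ x ∷ xs → y′ ∈ x ∷ xs → c y ≢ c y′ → ColourChange R c (x ∷ xs)
linked-colour-change c {x} {y = y} links y∈ y′∈ cy≢cy′ with c y Bool.≟ c x
... | no cy≢cx  = linked-colour-change-from-head c links y∈ cy≢cx
... | yes cy≡cx = linked-colour-change-from-head c links y′∈ (λ eq → cy≢cy′ (trans cy≡cx (sym eq)))

colour-split : ∀ {A B : Set} (c : B → Bool) {x y z} → c x ≢ c z → (c x ≢ c y → A) → (c y ≢ c z → A) → A
colour-split c {x} {y} cx≢cz left right with c x Bool.≟ c y
... | no  cx≢cy = left cx≢cy
... | yes cx≡cy = right (λ cy≡cz → cx≢cz (trans cx≡cy cy≡cz))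

countUpTo-+ : ∀ {k} (h : ℕ → Fin k) j T n →
  countUpTo h j (T ℕ.+ n) ≡ countUpTo h j T ℕ.+ countUpTo (λ r → h (T ℕ.+ r)) j n
countUpTo-+ h j T zero = trans (cong (countUpTo h j) (ℕ.+-identityʳ T)) (sym (ℕ.+-identityʳ _))
countUpTo-+ h j T (suc n) rewrite ℕ.+-suc T n with does (h (suc (T ℕ.+ n)) ≟ j)
... | true  = trans (cong suc (countUpTo-+ h j T n)) (sym (ℕ.+-suc _ _))
... | false = countUpTo-+ h j T n

countUpTo-mono : ∀ {k} (h : ℕ → Fin k) j {t t′} → t ℕ.≤ t′ → countUpTo h j t ℕ.≤ countUpTo h j t′
countUpTo-mono h j {t} t≤t′ with d , refl ← ℕ.m≤n⇒∃[o]m+o≡n t≤t′ =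
  subst (countUpTo h j t ℕ.≤_) (sym (countUpTo-+ h j t d)) (ℕ.m≤m+n _ _)

countUpTo-miss : ∀ {k} (h : ℕ → Fin k) j n → (∀ {r} → r ℕ.< n → h (suc r) ≢ j) → countUpTo h j n ≡ 0
countUpTo-miss h j zero    miss = refl
countUpTo-miss h j (suc n) miss with h (suc n) ≟ j
... | yes hit = contradiction hit (miss (ℕ.n<1+n n))
... | no _    = countUpTo-miss h j n (miss ∘ ℕ.m<n⇒m<1+n)

countUpTo-once : ∀ {k} (h : ℕ → Fin k) j n →
  (∀ {r r′} → r ℕ.< n → r′ ℕ.< n → h (suc r) ≡ h (suc r′) → r ≡ r′) →
  (∃ λ b → b ℕ.< n × h (suc b) ≡ j) → countUpTo h j n ≡ 1
countUpTo-once h j (suc n) inj (b , b<1+n , hit) with h (suc n) ≟ j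
... | yes hit′ = cong suc (countUpTo-miss h j n λ r<n eq →
                   ℕ.<⇒≢ r<n (inj (ℕ.m<n⇒m<1+n r<n) (ℕ.n<1+n n) (trans eq (sym hit′))))
... | no miss with ℕ.m<1+n⇒m<n∨m≡n b<1+n
...   | inj₂ refl = contradiction hit miss
...   | inj₁ b<n  = countUpTo-once h j n (λ r< r′< → inj (ℕ.m<n⇒m<1+n r<) (ℕ.m<n⇒m<1+n r′<)) (b , b<n , hit)

module _ {k} (h : ℕ → Fin k) (j : Fin k) (Q : ℕ) .{{_ : NonZero Q}}
         (once-per-block : ∀ T → countUpTo (λ r → h (T ℕ.+ r)) j Q ≡ 1) where

  countUpTo-blocks : ∀ ρ N → countUpTo h j (ρ ℕ.+ N ℕ.* Q) ≡ countUpTo h j ρ ℕ.+ N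
  countUpTo-blocks ρ zero = trans (cong (countUpTo h j) (ℕ.+-identityʳ ρ)) (sym (ℕ.+-identityʳ _))
  countUpTo-blocks ρ (suc N) = begin
    countUpTo h j (ρ ℕ.+ (Q ℕ.+ M))     ≡⟨ cong (countUpTo h j) (trans (cong (ρ ℕ.+_) (ℕ.+-comm Q M))
                                                                      (sym (ℕ.+-assoc ρ M Q))) ⟩
    countUpTo h j (ρ ℕ.+ M ℕ.+ Q)       ≡⟨ countUpTo-+ h j (ρ ℕ.+ M) Q ⟩
    countUpTo h j (ρ ℕ.+ M) ℕ.+ _       ≡⟨ cong₂ ℕ._+_ (countUpTo-blocks ρ N) (once-per-block (ρ ℕ.+ M)) ⟩
    countUpTo h j ρ ℕ.+ N ℕ.+ 1         ≡⟨ trans (ℕ.+-assoc _ N 1) (cong (countUpTo h j ρ ℕ.+_) (ℕ.+-comm N 1)) ⟩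
    countUpTo h j ρ ℕ.+ suc N           ∎
    where
    open ≡-Reasoning
    M = N ℕ.* Q

  countUpTo-bounds : ∀ T → Q ℕ.* countUpTo h j T ℕ.≤ T ℕ.+ Q × T ℕ.≤ Q ℕ.* countUpTo h j T ℕ.+ Q
  countUpTo-bounds T = upper , lower
    where
    ρ = T % Q
    N = T / Q
    c = countUpTo h j ρ
    T≡ρ+NQ : T ≡ ρ ℕ.+ N ℕ.* Q
    T≡ρ+NQ = m≡m%n+[m/n]*n T Q
    count≡c+N : countUpTo h j T ≡ c ℕ.+ N
    count≡c+N = trans (cong (countUpTo h j) T≡ρ+NQ) (countUpTo-blocks ρ N)
    c≤1 : c ℕ.≤ 1
    c≤1 = ℕ.≤-trans (countUpTo-mono h j (ℕ.<⇒≤ (m%n<n T Q))) (ℕ.≤-reflexive (once-per-block 0))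
    open ℕ.≤-Reasoning
    upper : Q ℕ.* countUpTo h j T ℕ.≤ T ℕ.+ Q
    upper = begin
      Q ℕ.* countUpTo h j T     ≡⟨ trans (cong (Q ℕ.*_) count≡c+N) (ℕ.*-distribˡ-+ Q c N) ⟩
      Q ℕ.* c ℕ.+ Q ℕ.* N       ≤⟨ ℕ.+-mono-≤ (ℕ.*-monoʳ-≤ Q c≤1) (ℕ.≤-reflexive (ℕ.*-comm Q N)) ⟩
      Q ℕ.* 1 ℕ.+ N ℕ.* Q       ≤⟨ ℕ.+-monoʳ-≤ (Q ℕ.* 1) (ℕ.m≤n+m (N ℕ.* Q) ρ) ⟩
      Q ℕ.* 1 ℕ.+ (ρ ℕ.+ N ℕ.* Q) ≡⟨ cong₂ ℕ._+_ (ℕ.*-identityʳ Q) (sym T≡ρ+NQ) ⟩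
      Q ℕ.+ T                   ≡⟨ ℕ.+-comm Q T ⟩
      T ℕ.+ Q                   ∎
    lower : T ℕ.≤ Q ℕ.* countUpTo h j T ℕ.+ Q
    lower = begin
      T                         ≡⟨ T≡ρ+NQ ⟩
      ρ ℕ.+ N ℕ.* Q             ≤⟨ ℕ.+-monoˡ-≤ (N ℕ.* Q) (ℕ.<⇒≤ (m%n<n T Q)) ⟩
      Q ℕ.+ N ℕ.* Q             ≡⟨ cong (Q ℕ.+_) (ℕ.*-comm N Q) ⟩
      Q ℕ.+ Q ℕ.* N             ≤⟨ ℕ.+-monoʳ-≤ Q (ℕ.*-monoʳ-≤ Q (ℕ.m≤n+m N c)) ⟩
      Q ℕ.+ Q ℕ.* (c ℕ.+ N)     ≡⟨ cong (λ x → Q ℕ.+ Q ℕ.* x) (sym count≡c+N) ⟩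
      Q ℕ.+ Q ℕ.* countUpTo h j T ≡⟨ ℕ.+-comm Q _ ⟩
      Q ℕ.* countUpTo h j T ℕ.+ Q ∎

∣⊖∣≤ : ∀ {a b d} → a ℕ.≤ b ℕ.+ d → b ℕ.≤ a ℕ.+ d → ℤ.∣ a ⊖ b ∣ ℕ.≤ d
∣⊖∣≤ {a} {b} a≤b+d b≤a+d with a ℕ.≤? b
... | yes a≤b = subst (ℕ._≤ _) (sym (ℤ.∣⊖∣-≤ a≤b)) (ℕ.m≤n+o⇒m∸n≤o b a b≤a+d)
... | no  a≰b = subst (ℕ._≤ _) (trans (sym (ℤ.∣⊖∣-≤ (ℕ.<⇒≤ (ℕ.≰⇒> a≰b)))) (ℤ.∣m⊖n∣≡∣n⊖m∣ b a))
                      (ℕ.m≤n+o⇒m∸n≤o a b a≤b+d)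

-- |c/T − 1/Q| = |cQ − T|/(TQ) ≤ 1/T, which is below ε = (p+1)/(d+1) once T > d + 1.
ratio-close : ∀ c T′ Q′ → suc Q′ ℕ.* c ℕ.≤ suc T′ ℕ.+ suc Q′ → suc T′ ℕ.≤ suc Q′ ℕ.* c ℕ.+ suc Q′ →
  ∀ p d-1 .{coprime : Coprime (suc p) (suc d-1)} → suc d-1 ℕ.≤ T′ →
  ∣ (+ c) ℚ./ suc T′ - (+ 1) ℚ./ suc Q′ ∣ < mkℚ (+ suc p) d-1 coprime
ratio-close c T′ Q′ upper lower p d-1 d<T =
  ℚ.toℚᵘ-cancel-< (ℚᵘ.<-respˡ-≃ (ℚᵘ.≃-sym as-ℚᵘ) (ℚᵘ.*<* numerators<))
  where
  T = suc T′
  Q = suc Q′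
  c/T = ℚᵘ.mkℚᵘ (+ c) T′
  1/Q = ℚᵘ.mkℚᵘ (+ 1) Q′
  as-ℚᵘ : toℚᵘ ∣ ℚ.fromℚᵘ c/T - ℚ.fromℚᵘ 1/Q ∣ ℚᵘ.≃ ℚᵘ.∣ c/T ℚᵘ.+ ℚᵘ.- 1/Q ∣
  as-ℚᵘ = ℚᵘ.≃-trans (ℚ.toℚᵘ-homo-∣-∣ (ℚ.fromℚᵘ c/T - ℚ.fromℚᵘ 1/Q))
    (ℚᵘ.∣-∣-cong (ℚᵘ.≃-trans (ℚ.toℚᵘ-homo-+ (ℚ.fromℚᵘ c/T) (- ℚ.fromℚᵘ 1/Q))
      (ℚᵘ.+-cong (ℚ.toℚᵘ-fromℚᵘ c/T)
        (ℚᵘ.≃-trans (ℚ.toℚᵘ-homo‿- (ℚ.fromℚᵘ 1/Q)) (ℚᵘ.-‿cong (ℚ.toℚᵘ-fromℚᵘ 1/Q))))))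
  numerator : ℤ
  numerator = + c ℤ.* + Q ℤ.+ ℤ.- (+ 1) ℤ.* + T
  numerator≡ : numerator ≡ c ℕ.* Q ⊖ T
  numerator≡ = trans (cong₂ ℤ._+_ (sym (ℤ.pos-* c Q)) (ℤ.-1*i≡-i (+ T))) (ℤ.m-n≡m⊖n (c ℕ.* Q) T)
  ∣numerator∣≤Q : ℤ.∣ numerator ∣ ℕ.≤ Q
  ∣numerator∣≤Q = subst (λ z → ℤ.∣ z ∣ ℕ.≤ Q) (sym numerator≡)
    (∣⊖∣≤ (subst (ℕ._≤ T ℕ.+ Q) (ℕ.*-comm Q c) upper) (subst (λ z → T ℕ.≤ z ℕ.+ Q) (ℕ.*-comm Q c) lower))
  open ℕ.≤-Reasoning
  numerators< : + ℤ.∣ numerator ∣ ℤ.* + suc d-1 ℤ.< + suc p ℤ.* + (T ℕ.* Q)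
  numerators< = subst₂ ℤ._<_ (ℤ.pos-* ℤ.∣ numerator ∣ (suc d-1)) (ℤ.pos-* (suc p) (T ℕ.* Q)) (ℤ.+<+ (begin-strict
    ℤ.∣ numerator ∣ ℕ.* suc d-1  ≤⟨ ℕ.*-monoˡ-≤ (suc d-1) ∣numerator∣≤Q ⟩
    Q ℕ.* suc d-1                <⟨ ℕ.*-monoʳ-< Q (s≤s d<T) ⟩
    Q ℕ.* T                      ≡⟨ ℕ.*-comm Q T ⟩
    T ℕ.* Q                      ≤⟨ ℕ.m≤n*m (T ℕ.* Q) (suc p) ⟩
    suc p ℕ.* (T ℕ.* Q)          ∎))

ratio-converges : ∀ Q .{{_ : NonZero Q}} (c : ℕ → ℕ) →
  (∀ T → Q ℕ.* c T ℕ.≤ T ℕ.+ Q × T ℕ.≤ Q ℕ.* c T ℕ.+ Q) →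
  ∀ ε → 0ℚ < ε → ∃[ T₀ ] ∀ t → T₀ ℕ.≤ t → ∣ (+ c (suc t)) ℚ./ suc t - (+ 1) ℚ./ Q ∣ < ε
ratio-converges (suc Q′) c bounds (mkℚ (+ suc p) d-1 coprime) _ =
  suc d-1 , λ t d<t → ratio-close (c (suc t)) t Q′ (proj₁ (bounds (suc t))) (proj₂ (bounds (suc t))) p d-1 {coprime} d<t
ratio-converges (suc Q′) c bounds (mkℚ (+ zero) _ _) (*<* (ℤ.+<+ ()))
ratio-converges (suc Q′) c bounds (mkℚ -[1+ _ ] _ _) (*<* ())

-- Occurrences and feasible assignments

intersect : ∀ {a b c d} → a < b → c < d → c < b → a < d → Intersect a b c d
intersect {a} {b} {c} {d} a<b c<d c<b a<d with a ≤? c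
... | yes a≤c = c , (a≤c , c<b) , (≤-refl , c<d)
... | no  a≰c = a , (≤-refl , a<b) , (<⇒≤ (≰⇒> a≰c) , a<d)

intersect-sym : ∀ {a b c d} → Intersect a b c d → Intersect c d a b
intersect-sym (x , in-ab , in-cd) = x , in-cd , in-ab

intersect-shift : ∀ t {a b c d} → Intersect (t + a) (t + b) (t + c) (t + d) → Intersect a b c d
intersect-shift t (x , (a≤x , x<b) , (c≤x , x<d)) =
  - t + x , (unshift-≤ a≤x , unshift-< x<b) , (unshift-≤ c≤x , unshift-< x<d)
  where
  open +-*-Solver
  -t+[t+y]≡y : ∀ y → - t + (t + y) ≡ y
  -t+[t+y]≡y = solve 2 (λ t y → (:- t) :+ (t :+ y) := y) refl t
  unshift-≤ : ∀ {y} → t + y ≤ x → y ≤ - t + x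
  unshift-≤ {y} le = subst (_≤ - t + x) (-t+[t+y]≡y y) (+-monoʳ-≤ (- t) le)
  unshift-< : ∀ {y} → x < t + y → - t + x < y
  unshift-< {y} lt = subst (- t + x <_) (-t+[t+y]≡y y) (+-monoʳ-< (- t) lt)

module Schedules (I : Instance) where

  private
    N = n I
    Q = q I

  -- Opaque, so that the checker never unfolds the rational arithmetic in their definitions.
  opaque
    S E : Fin N → ℕ → ℚ
    S i r = s I i + ℕtoℚ r
    E i r = e I i + ℕtoℚ r

    overlap⇒intersect : ∀ {i r i′ r′} → Overlap I i r i′ r′ → Intersect (S i r) (E i r) (S i′ r′) (E i′ r′)
    overlap⇒intersect ov = ov

    intersect⇒overlap : ∀ {i r i′ r′} → Intersect (S i r) (E i r) (S i′ r′) (E i′ r′) → Overlap I i r i′ r′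
    intersect⇒overlap ov = ov

    S-+ : ∀ i r a → S i (r ℕ.+ a) ≡ ℕtoℚ a + S i r
    S-+ i r a = trans (cong (_+_ (s I i)) (ℕtoℚ-+ r a))
      (solve 3 (λ x y z → x :+ (y :+ z) := z :+ (x :+ y)) refl (s I i) (ℕtoℚ r) (ℕtoℚ a))
      where open +-*-Solver

    E-+ : ∀ i r a → E i (r ℕ.+ a) ≡ ℕtoℚ a + E i r
    E-+ i r a = trans (cong (_+_ (e I i)) (ℕtoℚ-+ r a))
      (solve 3 (λ x y z → x :+ (y :+ z) := z :+ (x :+ y)) refl (e I i) (ℕtoℚ r) (ℕtoℚ a))
      where open +-*-Solver

    r<E : ∀ i r → ℕtoℚ r < E i r
    r<E i r = subst (_< E i r) (+-identityˡ (ℕtoℚ r)) (+-monoˡ-< (ℕtoℚ r) (e>0 I i))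

    E≤1+r : ∀ i r → E i r ≤ ℕtoℚ (suc r)
    E≤1+r i r = subst (E i r ≤_) (sym (ℕtoℚ-+ 1 r)) (+-monoˡ-≤ (ℕtoℚ r) (e≤1 I i))

    r<S[1+r] : ∀ i r → ℕtoℚ r < S i (suc r)
    r<S[1+r] i r = subst₂ _<_ -1+[1+r]≡r (cong (_+_ (s I i)) (sym (ℕtoℚ-+ 1 r))) (+-monoˡ-< (1ℚ + ℕtoℚ r) (s>-1 I i))
      where
      open +-*-Solver
      -1+[1+r]≡r : - 1ℚ + (1ℚ + ℕtoℚ r) ≡ ℕtoℚ r
      -1+[1+r]≡r = solve 1 (λ x → (:- con 1ℚ) :+ (con 1ℚ :+ x) := x) refl (ℕtoℚ r)

    E≤S[1+r] : ∀ i r → E i r ≤ S i (suc r)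
    E≤S[1+r] i r = begin
      e I i + ℕtoℚ r
        ≡⟨ solve 3 (λ a b c → a :+ c := (a :- b) :+ (b :+ c)) refl (e I i) (s I i) (ℕtoℚ r) ⟩
      (e I i - s I i) + (s I i + ℕtoℚ r)    ≤⟨ +-monoˡ-≤ (s I i + ℕtoℚ r) (len≤1 I i) ⟩
      1ℚ + (s I i + ℕtoℚ r)
        ≡⟨ solve 3 (λ a b c → a :+ (b :+ c) := b :+ (a :+ c)) refl 1ℚ (s I i) (ℕtoℚ r) ⟩
      s I i + (ℕtoℚ 1 + ℕtoℚ r)             ≡⟨ cong (_+_ (s I i)) (sym (ℕtoℚ-+ 1 r)) ⟩
      S i (suc r)                           ∎
      where
      open +-*-Solver
      open ℚ.≤-Reasoning

    S-mono : ∀ i {r r′} → r ℕ.≤ r′ → S i r ≤ S i r′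
    S-mono i r≤r′ = +-monoʳ-≤ (s I i) (ℕtoℚ-mono-≤ r≤r′)

    U⇒S≤r : ∀ {i} r → InU I i → S i r ≤ ℕtoℚ r
    U⇒S≤r {i} r s≤0 = subst (S i r ≤_) (+-identityˡ (ℕtoℚ r)) (+-monoˡ-≤ (ℕtoℚ r) s≤0)

    S<r⇒U : ∀ {i r} → S i r < ℕtoℚ r → InU I i
    S<r⇒U {i} {r} S<r = ≮⇒≥ λ 0<s →
      <⇒≱ S<r (subst (_≤ S i r) (+-identityˡ (ℕtoℚ r)) (+-monoˡ-≤ (ℕtoℚ r) (<⇒≤ 0<s)))

  Active : Fin N → ℕ → ℚ → Set
  Active i r τ = S i r < τ × τ < E i r

  E≤S-later : ∀ i {r r′} → r ℕ.< r′ → E i r ≤ S i r′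
  E≤S-later i {r} r<r′ = ≤-trans (E≤S[1+r] i r) (S-mono i r<r′)

  U⇒nonempty : ∀ {i} r → InU I i → S i r < E i r
  U⇒nonempty {i} r u = ≤-<-trans (U⇒S≤r r u) (r<E i r)

  overlap-sym : ∀ {i r i′ r′} → Overlap I i r i′ r′ → Overlap I i′ r′ i r
  overlap-sym {i} {r} {i′} {r′} ov =
    intersect⇒overlap {i′} {r′} {i} {r} (intersect-sym (overlap⇒intersect {i} {r} {i′} {r′} ov))

  overlap-shift : ∀ a {i r i′ r′} → Overlap I i (r ℕ.+ a) i′ (r′ ℕ.+ a) → Overlap I i r i′ r′
  overlap-shift a {i} {r} {i′} {r′} ov with overlap⇒intersect {i} {r ℕ.+ a} {i′} {r′ ℕ.+ a} ov
  ... | x , (S≤x , x<E) , (S′≤x , x<E′) = intersect⇒overlap {i} {r} {i′} {r′} (intersect-shift (ℕtoℚ a)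
    (x , (subst (_≤ x) (S-+ i r a) S≤x , subst (x <_) (E-+ i r a) x<E)
       , (subst (_≤ x) (S-+ i′ r′ a) S′≤x , subst (x <_) (E-+ i′ r′ a) x<E′)))

  overlap⇒adjacent : ∀ {i r i′ r′} → Overlap I i r i′ (suc r′) → r′ ℕ.≤ r
  overlap⇒adjacent {i} {r} {i′} {r′} ov with overlap⇒intersect {i} {r} {i′} {suc r′} ov
  ... | x , (_ , x<E) , (S′≤x , _) = ℕ.s≤s⁻¹ (ℕtoℚ-cancel-<
    (<-≤-trans (r<S[1+r] i′ r′) (≤-trans S′≤x (<⇒≤ (<-≤-trans x<E (E≤1+r i r))))))

  overlap-next-day⇒U : ∀ {i r i′} → Overlap I i r i′ (suc r) → InU I i′
  overlap-next-day⇒U {i} {r} {i′} ov with overlap⇒intersect {i} {r} {i′} {suc r} ov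
  ... | x , (_ , x<E) , (S′≤x , _) = S<r⇒U {i′} {suc r} (≤-<-trans S′≤x (<-≤-trans x<E (E≤1+r i r)))

  feasible-meet : ∀ {g} → Feasible I g → ∀ {i r i′ r′} → 1 ℕ.≤ r → 1 ℕ.≤ r′ → (i , r) ≢ (i′ , r′) →
    S i r < E i r → S i′ r′ < E i′ r′ → S i′ r′ < E i r → S i r < E i′ r′ → g i r ≢ g i′ r′
  feasible-meet fe {i} {r} {i′} {r′} 1≤r 1≤r′ occ≢ ne ne′ S′<E S<E′ with i ≟ i′
  ... | no i≢i′ =
    fe i i′ r r′ 1≤r 1≤r′ i≢i′ (intersect⇒overlap {i} {r} {i′} {r′} (intersect ne ne′ S′<E S<E′))
  ... | yes refl with ℕ.<-cmp r r′
  ...   | tri< r<r′ _ _ = ⊥-elim (<⇒≱ S′<E (E≤S-later i r<r′))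
  ...   | tri≈ _ refl _ = ⊥-elim (occ≢ refl)
  ...   | tri> _ _ r′<r = ⊥-elim (<⇒≱ S<E′ (E≤S-later i r′<r))

  feasible-active : ∀ {g} → Feasible I g → ∀ {i r i′ r′ τ} → 1 ℕ.≤ r → 1 ℕ.≤ r′ → (i , r) ≢ (i′ , r′) →
    Active i r τ → Active i′ r′ τ → g i r ≢ g i′ r′
  feasible-active fe 1≤r 1≤r′ occ≢ (S<τ , τ<E) (S′<τ , τ<E′) =
    feasible-meet fe 1≤r 1≤r′ occ≢ (<-trans S<τ τ<E) (<-trans S′<τ τ<E′) (<-trans S′<τ τ<E) (<-trans S<τ τ<E′)

  Idle : Assignment I → ℚ → Fin Q → Set
  Idle g τ w = ∀ i r → 1 ℕ.≤ r → g i r ≡ w → ¬ Active i r τ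

  idle-at-start : ∀ {g} → Feasible I g → ∀ {i r} → 1 ℕ.≤ r → S i r < E i r → Idle g (S i r) (g i r)
  idle-at-start fe {i} {r} 1≤r ne i′ r′ 1≤r′ eq (S′<S , S<E′) =
    feasible-meet fe 1≤r 1≤r′ (λ { refl → <-irrefl refl S′<S }) ne (<-trans S′<S S<E′)
      (<-trans S′<S ne) S<E′ (sym eq)

  idle-at-end : ∀ {g} → Feasible I g → ∀ {i r} → 1 ℕ.≤ r → S i r < E i r → Idle g (E i r) (g i r)
  idle-at-end fe {i} {r} 1≤r ne i′ r′ 1≤r′ eq (S′<E , E<E′) =
    feasible-meet fe 1≤r 1≤r′ (λ { refl → <-irrefl refl E<E′ }) ne (<-trans S′<E E<E′)
      S′<E (<-trans ne E<E′) (sym eq)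

  day-injective : ∀ {g} → Feasible I g → ∀ {r u u′} → 1 ℕ.≤ r → InU I u → InU I u′ → g u r ≡ g u′ r → u ≡ u′
  day-injective fe {r} {u} {u′} 1≤r u∈U u′∈U eq with u ≟ u′
  ... | yes u≡u′ = u≡u′
  ... | no  u≢u′ = ⊥-elim (feasible-meet fe 1≤r 1≤r (u≢u′ ∘ cong proj₁) (U⇒nonempty r u∈U) (U⇒nonempty r u′∈U)
                     (≤-<-trans (U⇒S≤r r u′∈U) (r<E u r)) (≤-<-trans (U⇒S≤r r u∈U) (r<E u′ r)) eq)

  day-surjective : sizeU I ≡ Q → ∀ {g} → Feasible I g → ∀ {r} → 1 ℕ.≤ r → ∀ w → ∃ λ u → InU I u × g u r ≡ w
  day-surjective sz {g} fe {r} 1≤r w =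
    let k , eq = injective⇒surjective (ℕ.≤-reflexive (sym sz)) worker-injective w
    in lookup U-list k , inU k , eq
    where
    U-list = filter (λ i → s I i ≤? 0ℚ) (allFin N)
    inU : ∀ k → InU I (lookup U-list k)
    inU k = proj₂ (∈-filter⁻ (λ i → s I i ≤? 0ℚ) {xs = allFin N} (∈-lookup k))
    worker-injective : Injective _≡_ _≡_ (λ k → g (lookup U-list k) r)
    worker-injective {k} {k′} eq = lookup-injective
      (Unique.filter⁺ (λ i → s I i ≤? 0ℚ) (Unique.allFin⁺ N)) (day-injective fe 1≤r (inU k) (inU k′) eq)

  Transition : Assignment I → (Fin Q → Fin Q) → Set
  Transition g σ = ∀ u → InU I u → σ (g u 1) ≡ g u 2

  transition-exists : sizeU I ≡ Q → ∀ {g} → Feasible I g → ∃ (Transition g)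
  transition-exists sz {g} fe = σ , σ-transition
    where
    day-1 = day-surjective sz fe {1} (s≤s z≤n)
    σ : Fin Q → Fin Q
    σ w = g (proj₁ (day-1 w)) 2
    σ-transition : Transition g σ
    σ-transition u u∈U = let _ , v∈U , eq = day-1 (g u 1) in
      cong (λ v → g v 2) (day-injective fe (s≤s z≤n) v∈U u∈U eq)

  transition-injective : sizeU I ≡ Q → ∀ {g σ} → Feasible I g → Transition g σ → Injective _≡_ _≡_ σ
  transition-injective sz {g} fe tr {w} {w′} eq
    with u , u∈U , refl ← day-surjective sz fe {1} (s≤s z≤n) w
       | u′ , u′∈U , refl ← day-surjective sz fe {1} (s≤s z≤n) w′ =
    cong (λ v → g v 1) (day-injective fe (s≤s z≤n) u∈U u′∈U (trans (sym (tr u u∈U)) (trans eq (tr u′ u′∈U))))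

  -- Exchanging two workers from some time on

  swapAfter : Assignment I → ℚ → Fin Q → Fin Q → Assignment I
  swapAfter g τ a b i r with τ ≤? S i r
  ... | yes _ = transpose a b (g i r)
  ... | no  _ = g i r

  module _ {g τ a b} (feasible : Feasible I g) (a-idle : Idle g τ a) (b-idle : Idle g τ b) where

    busy⇒neither : ∀ {i r} → 1 ℕ.≤ r → Active i r τ → g i r ≢ a × g i r ≢ b
    busy⇒neither {i} {r} 1≤r active = (λ eq → a-idle i r 1≤r eq active) , (λ eq → b-idle i r 1≤r eq active)

    -- An occurrence starting before τ and meeting one starting after τ is active at τ.
    swap-crossing : ∀ {i r i′ r′} → 1 ℕ.≤ r → 1 ℕ.≤ r′ → i ≢ i′ → Overlap I i r i′ r′ →
                    S i r < τ → τ ≤ S i′ r′ → g i r ≢ transpose a b (g i′ r′)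
    swap-crossing {i} {r} {i′} {r′} 1≤r 1≤r′ i≢i′ ov S<τ τ≤S′ eq with overlap⇒intersect {i} {r} {i′} {r′} ov
    ... | x , (_ , x<E) , (S′≤x , _) =
      feasible i i′ r r′ 1≤r 1≤r′ i≢i′ ov (begin
        g i r                                    ≡⟨ sym (transpose-fixes ≢b ≢a) ⟩
        transpose b a (g i r)                    ≡⟨ cong (transpose b a) eq ⟩
        transpose b a (transpose a b (g i′ r′))  ≡⟨ transpose-inverse b a ⟩
        g i′ r′                                  ∎)
      where
      open ≡-Reasoning
      ≢a = proj₁ (busy⇒neither 1≤r (S<τ , ≤-<-trans τ≤S′ (≤-<-trans S′≤x x<E)))
      ≢b = proj₂ (busy⇒neither 1≤r (S<τ , ≤-<-trans τ≤S′ (≤-<-trans S′≤x x<E)))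

    swapAfter-feasible : Feasible I (swapAfter g τ a b)
    swapAfter-feasible i i′ r r′ 1≤r 1≤r′ i≢i′ ov eq with τ ≤? S i r | τ ≤? S i′ r′
    ... | yes _   | yes _    = feasible i i′ r r′ 1≤r 1≤r′ i≢i′ ov (transpose-injective a b eq)
    ... | no  _   | no  _    = feasible i i′ r r′ 1≤r 1≤r′ i≢i′ ov eq
    ... | no  τ≰S | yes τ≤S′ = swap-crossing {i} {r} {i′} {r′} 1≤r 1≤r′ i≢i′ ov (≰⇒> τ≰S) τ≤S′ eq
    ... | yes τ≤S | no  τ≰S′ =
      swap-crossing 1≤r′ 1≤r (i≢i′ ∘ sym) (overlap-sym {i} {r} {i′} {r′} ov) (≰⇒> τ≰S′) τ≤S (sym eq)

    swapAfter-transition : ∀ {σ} → Transition g σ → 1ℚ < τ → τ ≤ ℕtoℚ 2 →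
                           Transition (swapAfter g τ a b) (transpose a b ∘ σ)
    swapAfter-transition tr 1<τ τ≤2 u u∈U with τ ≤? S u 1 | τ ≤? S u 2
    ... | yes τ≤S₁ | _        = ⊥-elim (<⇒≱ 1<τ (≤-trans τ≤S₁ (U⇒S≤r 1 u∈U)))
    ... | no  _    | yes _    = cong (transpose a b) (tr u u∈U)
    ... | no  _    | no  τ≰S₂ = trans (cong (transpose a b) (tr u u∈U)) (transpose-fixes ≢a ≢b)
      where
      ≢a = proj₁ (busy⇒neither (s≤s z≤n) (≰⇒> τ≰S₂ , ≤-<-trans τ≤2 (r<E u 2)))
      ≢b = proj₂ (busy⇒neither (s≤s z≤n) (≰⇒> τ≰S₂ , ≤-<-trans τ≤2 (r<E u 2)))

  -- A time at which workers of both colours are idle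

  active? : ∀ i r τ → Dec (Active i r τ)
  active? i r τ = (S i r <? τ) ×-dec (τ <? E i r)

  active-window : ∀ {i r τ} → 1 ℕ.≤ r → τ ≤ ℕtoℚ 2 → Active i r τ → r ℕ.≤ 2
  active-window {r = 1}                 _ _ _ = s≤s z≤n
  active-window {r = 2}                 _ _ _ = s≤s (s≤s z≤n)
  active-window {i} {r = suc (suc (suc r))} _ τ≤2 (S<τ , _) = ⊥-elim (<⇒≱
    (≤-<-trans (ℕtoℚ-mono-≤ {2} {suc (suc r)} (s≤s (s≤s z≤n))) (r<S[1+r] i (suc (suc r))))
    (≤-trans (<⇒≤ S<τ) τ≤2))

  -- Only days 1 and 2 can be active at times τ ≤ 2; bounding r makes Busy decidable.
  Busy : Assignment I → ℚ → Fin Q → Set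
  Busy g τ w = ∃ λ i → ∃ λ r → r ℕ.< 3 × (1 ℕ.≤ r × g i r ≡ w × Active i r τ)

  busy? : ∀ g τ w → Dec (Busy g τ w)
  busy? g τ w = any? λ i → ℕ.anyUpTo? (λ r → (1 ℕ.≤? r) ×-dec (g i r ≟ w) ×-dec active? i r τ) 3

  ¬busy⇒idle : ∀ {g τ w} → τ ≤ ℕtoℚ 2 → ¬ Busy g τ w → Idle g τ w
  ¬busy⇒idle τ≤2 ¬busy i r 1≤r eq active = ¬busy (i , r , s≤s (active-window 1≤r τ≤2 active) , 1≤r , eq , active)

  -- Both assignments keep the occurrences active at τ on distinct workers, so if every worker
  -- were busy under g, the workers h gives those occurrences would exhaust all workers, w′ included.
  idle-transfer : ∀ {g h τ w′} → Feasible I g → Feasible I h → τ ≤ ℕtoℚ 2 → Idle h τ w′ → ∃ (Idle g τ)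
  idle-transfer {g} {h} {τ} {w′} g-feasible h-feasible τ≤2 w′-idle =
    let w , ¬busy = ¬∀⟶∃¬ Q (Busy g τ) (busy? g τ) all-busy⇒⊥ in w , ¬busy⇒idle τ≤2 ¬busy
    where
    h-worker : ∀ {w} → Busy g τ w → Fin Q
    h-worker (i , r , _) = h i r
    h-worker-injective : ∀ {w w″} (b : Busy g τ w) (b″ : Busy g τ w″) → h-worker b ≡ h-worker b″ → w ≡ w″
    h-worker-injective (i , r , _ , 1≤r , refl , active) (i″ , r″ , _ , 1≤r″ , refl , active″) eq
      with ≡-dec _≟_ ℕ._≟_ (i , r) (i″ , r″)
    ... | yes refl = refl
    ... | no occ≢ = ⊥-elim (feasible-active h-feasible 1≤r 1≤r″ occ≢ active active″ eq)
    h-worker≢w′ : ∀ {w} (b : Busy g τ w) → h-worker b ≢ w′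
    h-worker≢w′ (i , r , _ , 1≤r , _ , active) hit = w′-idle i r 1≤r hit active
    all-busy⇒⊥ : (∀ w → Busy g τ w) → ⊥
    all-busy⇒⊥ busy =
      let w , hit = injective⇒surjective ℕ.≤-refl (h-worker-injective (busy _) (busy _)) w′
      in h-worker≢w′ (busy w) hit

  Endpoint : ℚ → Set
  Endpoint t = ∃ λ i → ∃ λ r → 1 ℕ.≤ r × r ℕ.≤ 2 × (S i r ≡ t ⊎ E i r ≡ t)

  endpoints : List ℚ
  endpoints = concatMap (λ i → S i 1 ∷ E i 1 ∷ S i 2 ∷ E i 2 ∷ []) (allFin N)

  endpoints-complete : ∀ {t} → Endpoint t → t ∈ endpoints
  endpoints-complete (i , r , 1≤r , r≤2 , end) = ∈-concatMap⁺ _ (lose (∈-allFin i) (listed r 1≤r r≤2 end))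
    where
    listed : ∀ {t} r → 1 ℕ.≤ r → r ℕ.≤ 2 → S i r ≡ t ⊎ E i r ≡ t → t ∈ S i 1 ∷ E i 1 ∷ S i 2 ∷ E i 2 ∷ []
    listed 1 _ _ (inj₁ refl) = here refl
    listed 1 _ _ (inj₂ refl) = there (here refl)
    listed 2 _ _ (inj₁ refl) = there (there (here refl))
    listed 2 _ _ (inj₂ refl) = there (there (there (here refl)))
    listed (suc (suc (suc _))) _ (s≤s (s≤s ())) _

  Covers : ℚ → ℚ → List ℚ → Set
  Covers p p′ ts = ∀ {t} → Endpoint t → p < t → t < p′ → t ∈ ts

  covers-narrow : ∀ {p p′ c ts a b} → Covers p p′ (c ∷ ts) → p ≤ a → b ≤ p′ →
                  (∀ {t} → a < t → t < b → t ≢ c) → Covers a b ts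
  covers-narrow cov p≤a b≤p′ avoids-c end a<t t<b with cov end (≤-<-trans p≤a a<t) (<-≤-trans t<b b≤p′)
  ... | here t≡c = contradiction t≡c (avoids-c a<t t<b)
  ... | there t∈ts = t∈ts

  module _ {f : Assignment I} {p p′ : ℚ} {w : Fin Q} (no-endpoints : Covers p p′ []) (p′≤2 : p′ ≤ ℕtoℚ 2) where

    idle-spreads-left : ∀ {a} → p ≤ a → a < p′ → Idle f a w → Idle f p w
    idle-spreads-left p≤a a<p′ a-idle i r 1≤r eq (S<p , p<E) =
      a-idle i r 1≤r eq (<-≤-trans S<p p≤a , <-≤-trans a<p′ p′≤E)
      where
      r≤2 = active-window 1≤r (≤-trans (≤-trans p≤a (<⇒≤ a<p′)) p′≤2) (S<p , p<E)
      p′≤E = ≮⇒≥ λ E<p′ → ¬Any[] (no-endpoints (i , r , 1≤r , r≤2 , inj₂ refl) p<E E<p′)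

    idle-spreads-right : ∀ {b} → p < b → b ≤ p′ → Idle f b w → Idle f p′ w
    idle-spreads-right p<b b≤p′ b-idle i r 1≤r eq (S<p′ , p′<E) =
      b-idle i r 1≤r eq (≤-<-trans S≤p p<b , ≤-<-trans b≤p′ p′<E)
      where
      r≤2 = active-window 1≤r p′≤2 (S<p′ , p′<E)
      S≤p = ≮⇒≥ λ p<S → ¬Any[] (no-endpoints (i , r , 1≤r , r≤2 , inj₁ refl) p<S S<p′)

  SwapPoint : Assignment I → (Fin Q → Bool) → Set
  SwapPoint g col = ∃ λ τ → (1ℚ < τ × τ ≤ ℕtoℚ 2) ×
    ∃ λ W₁ → ∃ λ W₂ → Idle g τ W₁ × Idle g τ W₂ × col W₁ ≢ col W₂

  module SwapTime {g h} (g-feasible : Feasible I g) (h-feasible : Feasible I h) (w′ : Fin Q) (col : Fin Q → Bool) where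

    record Bracket (p p′ : ℚ) : Set where
      field
        p≤p′     : p ≤ p′
        1<p      : 1ℚ < p
        p′≤2     : p′ ≤ ℕtoℚ 2
        h-idleˡ  : Idle h p w′
        h-idleʳ  : Idle h p′ w′
        left     : Fin Q
        right    : Fin Q
        g-idleˡ  : Idle g p left
        g-idleʳ  : Idle g p′ right
        colours  : col left ≢ col right

    record Divider (p p′ c : ℚ) : Set where
      field
        a b      : ℚ
        p≤a      : p ≤ a
        a≤c      : a ≤ c
        c≤b      : c ≤ b
        b≤p′     : b ≤ p′
        h-idle-a : Idle h a w′
        h-idle-b : Idle h b w′
        middle   : Fin Q
        g-idle-a : Idle g a middle
        g-idle-b : Idle g b middle

    -- At c, either w′ is busy under h with an occurrence, which lies inside [p, p′] and whose
    -- g-worker is free at both of its ends, or w′ is free under h and then some g-worker is free at c.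
    divide : ∀ {p p′ c} → Bracket p p′ → p < c → c < p′ → Divider p p′ c
    divide {p} {p′} {c} br p<c c<p′ with busy? h c w′
    ... | yes (i , r , _ , 1≤r , hit , S<c , c<E) = record
      { a = S i r ; b = E i r
      ; p≤a = ≮⇒≥ λ S<p → h-idleˡ i r 1≤r hit (S<p , <-trans p<c c<E)
      ; a≤c = <⇒≤ S<c ; c≤b = <⇒≤ c<E
      ; b≤p′ = ≮⇒≥ λ p′<E → h-idleʳ i r 1≤r hit (<-trans S<c c<p′ , p′<E)
      ; h-idle-a = subst (Idle h (S i r)) hit (idle-at-start h-feasible 1≤r nonempty)
      ; h-idle-b = subst (Idle h (E i r)) hit (idle-at-end h-feasible 1≤r nonempty)
      ; middle = g i r
      ; g-idle-a = idle-at-start g-feasible 1≤r nonempty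
      ; g-idle-b = idle-at-end g-feasible 1≤r nonempty
      }
      where
      open Bracket br
      nonempty = <-trans S<c c<E
    ... | no ¬busy = record
      { a = c ; b = c ; p≤a = <⇒≤ p<c ; a≤c = ≤-refl ; c≤b = ≤-refl ; b≤p′ = <⇒≤ c<p′
      ; h-idle-a = c-idle ; h-idle-b = c-idle
      ; middle = proj₁ g-free ; g-idle-a = proj₂ g-free ; g-idle-b = proj₂ g-free
      }
      where
      open Bracket br
      c≤2 = ≤-trans (<⇒≤ c<p′) p′≤2
      c-idle = ¬busy⇒idle c≤2 ¬busy
      g-free = idle-transfer g-feasible h-feasible c≤2 c-idle

    halve : ∀ {p p′ c} → Bracket p p′ → (d : Divider p p′ c) → Bracket p (Divider.a d) ⊎ Bracket (Divider.b d) p′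
    halve {p} {p′} br d = colour-split col {y = middle} colours
      (λ left≢middle → inj₁ record
        { p≤p′ = p≤a ; 1<p = 1<p ; p′≤2 = ≤-trans a≤p′ p′≤2
        ; h-idleˡ = h-idleˡ ; h-idleʳ = h-idle-a
        ; left = left ; right = middle ; g-idleˡ = g-idleˡ ; g-idleʳ = g-idle-a ; colours = left≢middle })
      (λ middle≢right → inj₂ record
        { p≤p′ = b≤p′ ; 1<p = <-≤-trans 1<p p≤b ; p′≤2 = p′≤2
        ; h-idleˡ = h-idle-b ; h-idleʳ = h-idleʳ
        ; left = middle ; right = right ; g-idleˡ = g-idle-b ; g-idleʳ = g-idleʳ ; colours = middle≢right })
      where
      open Bracket br
      open Divider d
      a≤p′ = ≤-trans a≤c (≤-trans c≤b b≤p′)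
      p≤b = ≤-trans p≤a (≤-trans a≤c c≤b)

    search-between : ∀ {p p′ c} → Bracket p p′ → Covers p p′ [] → p < c → c < p′ → SwapPoint g col
    search-between {p} {p′} br no-endpoints p<c c<p′ = colour-split {A = SwapPoint g col} col {y = middle} colours
      (λ left≢middle → p , (1<p , ≤-trans p≤p′ p′≤2) , left , middle , g-idleˡ , middle-idle-p , left≢middle)
      (λ middle≢right → p′ , (<-≤-trans 1<p p≤p′ , p′≤2) , middle , right , middle-idle-p′ , g-idleʳ , middle≢right)
      where
      open Bracket br
      open Divider (divide br p<c c<p′)
      middle-idle-p : Idle g p middle
      middle-idle-p = idle-spreads-left no-endpoints p′≤2 p≤a (≤-<-trans a≤c c<p′) g-idle-a
      middle-idle-p′ : Idle g p′ middle
      middle-idle-p′ = idle-spreads-right no-endpoints p′≤2 (<-≤-trans p<c c≤b) b≤p′ g-idle-b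

    search : ∀ ts {p p′} → Bracket p p′ → Covers p p′ ts → SwapPoint g col
    search [] {p} {p′} br no-endpoints with p′ ≤? p
    ... | yes p′≤p = p , (1<p , ≤-trans p≤p′ p′≤2) , left , right
                   , g-idleˡ , subst (λ t → Idle g t right) (≤-antisym p′≤p p≤p′) g-idleʳ , colours
      where open Bracket br
    ... | no p′≰p = let _ , p<c , c<p′ = <-dense (≰⇒> p′≰p) in search-between br no-endpoints p<c c<p′
    search (c ∷ ts) {p} {p′} br cov = search-at ((p <? c) ×-dec (c <? p′))
      where
      search-halves : Divider p p′ c → SwapPoint g col
      search-halves d = [
        (λ left-half → search ts left-half
          (covers-narrow cov ≤-refl (≤-trans a≤c (≤-trans c≤b b≤p′)) λ { _ t<a refl → <⇒≱ t<a a≤c })) ,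
        (λ right-half → search ts right-half
          (covers-narrow cov (≤-trans p≤a (≤-trans a≤c c≤b)) ≤-refl λ { b<t _ refl → <⇒≱ b<t c≤b })) ]′
        (halve br d)
        where open Divider d
      search-at : Dec (p < c × c < p′) → SwapPoint g col
      search-at (no c-outside)     =
        search ts br (covers-narrow cov ≤-refl ≤-refl λ { p<t t<p′ refl → c-outside (p<t , t<p′) })
      search-at (yes (p<c , c<p′)) = search-halves (divide br p<c c<p′)

    arc-bracket : ∀ {σ u u′} → Transition g σ → (∀ w → col (σ w) ≡ col w) → InU I u → InU I u′ →
                  h u 1 ≡ w′ → h u′ 2 ≡ w′ → col (g u 1) ≢ col (g u′ 1) → Bracket (E u 1) (S u′ 2)
    arc-bracket {σ} {u} {u′} tr col-σ u∈U u′∈U hu≡w′ hu′≡w′ colours = record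
      { p≤p′ = ≮⇒≥ λ S′<E →
          feasible-meet h-feasible 1≤1 1≤2 (λ ()) nonempty nonempty′ S′<E S<E′ (trans hu≡w′ (sym hu′≡w′))
      ; 1<p = r<E u 1
      ; p′≤2 = U⇒S≤r 2 u′∈U
      ; h-idleˡ = subst (Idle h (E u 1)) hu≡w′ (idle-at-end h-feasible 1≤1 nonempty)
      ; h-idleʳ = subst (Idle h (S u′ 2)) hu′≡w′ (idle-at-start h-feasible 1≤2 nonempty′)
      ; left = g u 1
      ; right = g u′ 2
      ; g-idleˡ = idle-at-end g-feasible 1≤1 nonempty
      ; g-idleʳ = idle-at-start g-feasible 1≤2 nonempty′
      ; colours = λ eq → colours (trans eq (trans (cong col (sym (tr u′ u′∈U))) (col-σ (g u′ 1))))
      }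
      where
      1≤1 : 1 ℕ.≤ 1
      1≤1 = s≤s z≤n
      1≤2 : 1 ℕ.≤ 2
      1≤2 = s≤s z≤n
      nonempty = U⇒nonempty 1 u∈U
      nonempty′ = U⇒nonempty 2 u′∈U
      S<E′ : S u 1 < E u′ 2
      S<E′ = ≤-<-trans (U⇒S≤r 1 u∈U) (≤-<-trans (ℕtoℚ-mono-≤ {1} {2} 1≤2) (r<E u′ 2))

  module _ (sz : sizeU I ≡ Q) (𝓕 : AssignmentSet I) (eulerian : Eulerian I 𝓕) where

    ColourChangingArc : Assignment I → (Fin Q → Bool) → Set
    ColourChangingArc g col = ∃ λ k → ∃ λ u → ∃ λ u′ →
      InU I u × InU I u′ × F 𝓕 k u 1 ≡ F 𝓕 k u′ 2 × col (g u 1) ≢ col (g u′ 1)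

    colour-changing-arc : ∀ {g} → Feasible I g → (col : Fin Q → Bool) → ∀ {w w′} → col w ≢ col w′ →
                          ColourChangingArc g col
    colour-changing-arc {g} fe col {w} {w′} w≢w′ = along eulerian
      where
      along : Eulerian I 𝓕 → ColourChangingArc g col
      along (_ , (a , as , refl , links) , arcs , _ , _ , visits)
        with u , u∈U , refl ← day-surjective sz fe {1} (s≤s z≤n) w
           | u′ , u′∈U , refl ← day-surjective sz fe {1} (s≤s z≤n) w′
        with (k , v) , _ , arc∈ , (v′∈U , same) , colours ← linked-colour-change (col ∘ (λ v → g v 1) ∘ proj₂) links
               (∈-++⁺ˡ (proj₂ (visits u u∈U))) (∈-++⁺ˡ (proj₂ (visits u′ u′∈U))) w≢w′
        = k , v , _ , All.lookup (All.++⁺ arcs (All.head arcs All.∷ All.[])) arc∈ , v′∈U , same , colours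

    swap-point : ∀ {g σ} → Feasible I g → Transition g σ → (col : Fin Q → Bool) → (∀ w → col (σ w) ≡ col w) →
                 ∀ {w w′} → col w ≢ col w′ → SwapPoint g col
    swap-point {g} fe tr col col-σ w≢w′ = from-arc (colour-changing-arc fe col w≢w′)
      where
      from-arc : ColourChangingArc g col → SwapPoint g col
      from-arc (k , u , u′ , u∈U , u′∈U , same , colours) =
        search endpoints (arc-bracket tr col-σ u∈U u′∈U refl (sym same) colours) (λ end _ _ → endpoints-complete end)
        where open SwapTime fe (AssignmentSet.feasible 𝓕 k) (F 𝓕 k u 1) col

    -- Growing a cycle of the transition

    record LongOrbit (k : ℕ) : Set where
      field
        g          : Assignment I
        feasible   : Feasible I g
        σ          : Fin Q → Fin Q
        transition : Transition g σ
        x          : Fin Q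
        distinct   : Orbit.Distinct σ x k

    initial : LongOrbit 0
    initial = record
      { g = F 𝓕 k₀ ; feasible = AssignmentSet.feasible 𝓕 k₀
      ; σ = proj₁ tr ; transition = proj₂ tr
      ; x = Fin.fromℕ< (ℕ.>-nonZero⁻¹ Q {{q≢0 I}}) ; distinct = λ () }
      where
      k₀ = proj₁ (proj₁ (proj₁ (proj₂ eulerian)))
      tr = transition-exists sz (AssignmentSet.feasible 𝓕 k₀)

    module _ {k} (orbit : LongOrbit k) where

      open LongOrbit orbit
      open Orbit σ
      open import Function.Endo.Propositional (Fin Q) using (_^_)

      private
        σ-injective : Injective _≡_ _≡_ σ
        σ-injective = transition-injective sz feasible transition

      module _ (returns : (σ ^ k) x ≡ x) where

        visited-σ : ∀ w → does (visits? x k (σ w)) ≡ does (visits? x k w)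
        visited-σ w with visits? x k (σ w) | visits? x k w
        ... | yes _ | yes _ = refl
        ... | no  _ | no  _ = refl
        ... | yes v | no  n = contradiction (visits-σ⁻ σ-injective returns v) n
        ... | no  n | yes v = contradiction (visits-σ returns v) n

        -- Composing σ with the transposition of a worker on its cycle through x and a worker
        -- off that cycle splices the second worker's cycle into it.
        merge-at : ∀ {τ W W′} → 1ℚ < τ → τ ≤ ℕtoℚ 2 → Idle g τ W → Idle g τ W′ →
                   Visits x k W → ¬ Visits x k W′ → LongOrbit (suc k)
        merge-at {τ} {W} {W′} 1<τ τ≤2 W-idle W′-idle (a , _ , refl) W′∉ = record
          { g = swapAfter g τ W W′
          ; feasible = swapAfter-feasible feasible W-idle W′-idle
          ; σ = transpose W W′ ∘ σ
          ; transition = swapAfter-transition feasible W-idle W′-idle {σ} transition 1<τ τ≤2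
          ; x = W
          ; distinct = transpose-merges (distinct-^ σ-injective a distinct) (return-^ {k = k} a returns)
                                        (W′∉ ∘ visits-rotate {k = k} a returns)
          }

        merge : 0 ℕ.< k → k ℕ.< Q → LongOrbit (suc k)
        merge 0<k k<Q = at-swap-point (swap-point feasible transition visited visited-σ x≢W)
          where
          visited : Fin Q → Bool
          visited w = does (visits? x k w)
          W = proj₁ (unvisited k<Q)
          x≢W : visited x ≢ visited W
          x≢W eq = contradiction (trans (sym (dec-true (visits? x k x) (0 , 0<k , refl)))
                                        (trans eq (dec-false (visits? x k W) (proj₂ (unvisited k<Q))))) λ ()
          at-swap-point : SwapPoint g visited → LongOrbit (suc k)
          at-swap-point (τ , (1<τ , τ≤2) , W₁ , W₂ , idle₁ , idle₂ , colours) with visits? x k W₁ | visits? x k W₂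
          ... | yes v₁ | no  n₂ = merge-at 1<τ τ≤2 idle₁ idle₂ v₁ n₂
          ... | no  n₁ | yes v₂ = merge-at 1<τ τ≤2 idle₂ idle₁ v₂ n₁
          ... | yes _  | yes _  = ⊥-elim (colours refl)
          ... | no  _  | no  _  = ⊥-elim (colours refl)

      extend : k ℕ.< Q → LongOrbit (suc k)
      extend k<Q with visits? x k ((σ ^ k) x)
      ... | no  new = record { g = g ; feasible = feasible ; σ = σ ; transition = transition ; x = x
                             ; distinct = distinct-extend distinct new }
      ... | yes old@(_ , j<k , _) = merge (distinct-return σ-injective {k = k} distinct old) (ℕ.≤-<-trans z≤n j<k) k<Q

    grow : ∀ k → k ℕ.≤ Q → LongOrbit k
    grow zero    _   = initial
    grow (suc k) k<Q = extend (grow k (ℕ.<⇒≤ k<Q)) k<Q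

  -- Unrolling a cyclic transition

  module Unrolling {g σ x} (sz : sizeU I ≡ Q) (feasible : Feasible I g) (transition : Transition g σ)
                   (distinct : Orbit.Distinct σ x Q) where

    open Orbit σ
    open import Function.Endo.Propositional (Fin Q) using (_^_)

    private
      σ-injective : Injective _≡_ _≡_ σ
      σ-injective = transition-injective sz feasible transition
      cycle : ∀ w → Distinct w Q × (σ ^ Q) w ≡ w
      cycle = full-cycle σ-injective distinct

    unrolled : Assignment I
    unrolled i r = (σ ^ (r ∸ 1)) (g i 1)

    unrolled-periodic : Periodic I unrolled Q
    unrolled-periodic i (suc a) _ = sym (trans (^-+ a Q (g i 1)) (cong (σ ^ a) (proj₂ (cycle (g i 1)))))

    same-day : ∀ a {i i′} → i ≢ i′ → Overlap I i (suc a) i′ (suc a) → unrolled i (suc a) ≢ unrolled i′ (suc a)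
    same-day a {i} {i′} i≢i′ ov eq =
      feasible i i′ 1 1 (s≤s z≤n) (s≤s z≤n) i≢i′ (overlap-shift a {i} {1} {i′} {1} ov) (^-injective σ-injective a eq)

    next-day : ∀ a {i i′} → i ≢ i′ → Overlap I i (suc a) i′ (suc (suc a)) →
               unrolled i (suc a) ≢ unrolled i′ (suc (suc a))
    next-day a {i} {i′} i≢i′ ov eq =
      feasible i i′ 1 2 (s≤s z≤n) (s≤s z≤n) i≢i′ (overlap-shift a {i} {1} {i′} {2} ov) (^-injective σ-injective a (begin
        (σ ^ a) (g i 1)        ≡⟨ eq ⟩
        σ ((σ ^ a) (g i′ 1))   ≡⟨ ^-comm 1 a (g i′ 1) ⟩
        (σ ^ a) (σ (g i′ 1))   ≡⟨ cong (σ ^ a) (transition i′ (overlap-next-day⇒U {i} {suc a} {i′} ov)) ⟩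
        (σ ^ a) (g i′ 2)       ∎))
      where open ≡-Reasoning

    unrolled-feasible : Feasible I unrolled
    unrolled-feasible i i′ (suc a) (suc b) _ _ i≢i′ ov with ℕ.<-cmp a b
    ... | tri≈ _ refl _ = same-day a i≢i′ ov
    ... | tri< a<b _ _ with refl ← ℕ.≤-antisym (overlap⇒adjacent {i} {suc a} {i′} {b} ov) a<b = next-day a i≢i′ ov
    ... | tri> _ _ b<a with ov′ ← overlap-sym {i} {suc a} {i′} {suc b} ov
      with refl ← ℕ.≤-antisym (overlap⇒adjacent {i′} {suc b} {i} {a} ov′) b<a = next-day b (i≢i′ ∘ sym) ov′ ∘ sym

    unrolled-block : ∀ i T r → unrolled i (T ℕ.+ suc r) ≡ (σ ^ r) ((σ ^ T) (g i 1))
    unrolled-block i T r = trans (cong (λ t → (σ ^ (t ∸ 1)) (g i 1)) (trans (ℕ.+-suc T r) (cong suc (ℕ.+-comm T r))))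
                                 (^-+ r T (g i 1))

    unrolled-balanced : Balanced I unrolled
    unrolled-balanced i j = ratio-converges Q {{q≢0 I}} (countUpTo (unrolled i) j)
      (countUpTo-bounds (unrolled i) j Q {{q≢0 I}} once-per-block)
      where
      once-per-block : ∀ T → countUpTo (λ r → unrolled i (T ℕ.+ r)) j Q ≡ 1
      once-per-block T = countUpTo-once _ j Q
        (λ r< r′< eq → proj₁ (cycle w) r< r′< (trans (sym (unrolled-block i T _)) (trans eq (unrolled-block i T _))))
        (let b , b<Q , hit = visits-all (proj₁ (cycle w)) j in b , b<Q , trans (unrolled-block i T b) hit)
        where w = (σ ^ T) (g i 1)

lemma3p3 : (I : Instance) → sizeU I ≡ q I → (𝓕 : AssignmentSet I) → Eulerian I 𝓕 →
    ∃[ f ] (Feasible I f × Balanced I f × Periodic I f (q I))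
lemma3p3 I sz 𝓕 eulerian = unrolled , unrolled-feasible , unrolled-balanced , unrolled-periodic
  where
  open Schedules I
  open LongOrbit (grow sz 𝓕 eulerian (q I) ℕ.≤-refl)
  open Unrolling sz feasible transition distinct
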